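{- Consider the Sign Game on the path graph $P_5$ with vertices $v_1, \dots, v_5$. (1) If Player 1 and Player 2, on their first moves, label $v_1$ and $v_5$ (in some order) with opposite signs, then Player 1, who labels two of the remaining three vertices, can guarantee a victory. If they label $v_1$ and $v_5$ on their first moves with the same sign, then Player 2 can force a draw. (2) Up to symmetry (reversing the path) and duality (interchanging all $+1$ and $-1$ values), exactly three complete assignments of values to the vertices of $P_5$ give a positive score, namely (listing values of $v_1,\dots,v_5$) $+++++$, $++++-$, $+++--$; exactly three give a negative score, namely $++-+-$, $+-++-$, $+-+-+$; and all other assignments give score $0$.
   Context: The Sign Game on a simple undirected graph $G$: two players, Player P and Player N, alternate turns; the one moving first is called Player 1, the other Player 2 (either of P, N may be Player 1). On a turn a player assigns $+1$ or $-1$ to a vertex of $G$ not yet assigned. Once both endpoints of an edge have been assigned, the edge takes the value of the product of its endpoint values. The game ends when all vertices are assigned, and the score $s(G)$ is the sum of all edge values. Player P wins if $s(G) > 0$, Player N wins if $s(G) < 0$, and the game is a draw if $s(G) = 0$. The path graph $P_5$ has vertices $v_1, \dots, v_5$ and edges $(v_i, v_{i+1})$ for $i = 1, \dots, 4$. -}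

module Defs where

open import Data.Bool using (Bool; true; false)
open import Data.Fin using (Fin; zero; suc)
open import Data.Integer using (ℤ; +_; -[1+_]; _+_; _*_; _<_)
open import Data.List using (List; []; _∷_; map; foldr)
open import Data.Maybe using (Maybe; just; nothing; Is-just)
open import Data.Vec using (Vec; lookup; replicate; reverse; _[_]≔_)
import Data.Vec as Vc
open import Data.Vec.Relation.Unary.All using (All)
open import Data.Vec.Relation.Unary.Any using (Any)
open import Data.Product using (Σ; _×_; _,_)
open import Data.Sum using (_⊎_)
open import Relation.Binary.PropositionalEquality using (_≡_)
open import Relation.Nullary using (¬_)

data Sign : Set where
  plus minus : Sign

toℤ : Sign → ℤ
toℤ plus  = + 1
toℤ minus = -[1+ 0 ]

flip : Sign → Sign
flip plus  = minus
flip minus = plus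

V : Set
V = Fin 5

v₁ v₂ v₃ v₄ v₅ : V
v₁ = zero
v₂ = suc zero
v₃ = suc (suc zero)
v₄ = suc (suc (suc zero))
v₅ = suc (suc (suc (suc zero)))

edges : List (V × V)
edges = (v₁ , v₂) ∷ (v₂ , v₃) ∷ (v₃ , v₄) ∷ (v₄ , v₅) ∷ []

-- Partial assignments (game positions): nothing = not yet assigned.

Position : Set
Position = Vec (Maybe Sign) 5

emptyPos : Position
emptyPos = replicate 5 nothing

edgeValue : Maybe Sign → Maybe Sign → ℤ
edgeValue (just a) (just b) = toℤ a * toℤ b
edgeValue _        _        = + 0

scorePos : Position → ℤ
scorePos s = foldr _+_ (+ 0) (map (λ e → edgeValue (lookup s (Data.Product.proj₁ e))
                                       (lookup s (Data.Product.proj₂ e))) edges)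

Complete : Position → Set
Complete s = All Is-just s

HasEmpty : Position → Set
HasEmpty s = Any (λ m → m ≡ nothing) s

Assignment : Set
Assignment = Vec Sign 5

score : Assignment → ℤ
score x = scorePos (Vc.map just x)

data Role : Set where
  P N : Role

Wins : Role → ℤ → Set
Wins P z = + 0 < z
Wins N z = z < + 0

opponent : Role → Role
opponent P = N
opponent N = P

-- Forcing: "the player we care about (call them Me) can guarantee that
-- the final score satisfies Q, from position s", where the Bool says
-- whether it is Me's turn (true) or the opponent's turn (false).

data Forces (Q : ℤ → Set) : Bool → Position → Set where
  done   : ∀ {t s} → Complete s → Q (scorePos s) → Forces Q t s
  mine   : ∀ {s} (i : V) (σ : Sign) → lookup s i ≡ nothing →
           Forces Q false (s [ i ]≔ just σ) → Forces Q true s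
  theirs : ∀ {s} → HasEmpty s →
           (∀ (i : V) (σ : Sign) → lookup s i ≡ nothing →
              Forces Q true (s [ i ]≔ just σ)) →
           Forces Q false s

revIf : Bool → Assignment → Assignment
revIf true  x = reverse x
revIf false x = x

dualIf : Bool → Assignment → Assignment
dualIf true  x = Vc.map flip x
dualIf false x = x

_∼_ : Assignment → Assignment → Set
x ∼ y = Σ Bool λ r → Σ Bool λ d → y ≡ revIf r (dualIf d x)

open Vc using ([]; _∷_)

ppppp ppppm pppmm ppmpm pmppm pmpmp : Assignment
ppppp = plus ∷ plus  ∷ plus  ∷ plus  ∷ plus  ∷ []
ppppm = plus ∷ plus  ∷ plus  ∷ plus  ∷ minus ∷ []
pppmm = plus ∷ plus  ∷ plus  ∷ minus ∷ minus ∷ []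
ppmpm = plus ∷ plus  ∷ minus ∷ plus  ∷ minus ∷ []
pmppm = plus ∷ minus ∷ plus  ∷ plus  ∷ minus ∷ []
pmpmp = plus ∷ minus ∷ plus  ∷ minus ∷ plus  ∷ []

-- Along the path the score is 4 − 2k, where k counts the edges whose endpoints
-- differ, and k is odd exactly when v₁ and v₅ differ. With opposite ends k ∈ {1, 3}:
-- P wins by giving v₂ the sign of v₁ and then copying the opponent's sign onto the
-- last inner vertex (k = 1); N wins by giving v₂ the sign opposite to v₁ and then
-- the sign of v₁ to the last inner vertex (k = 3). With equal ends k ∈ {0, 2, 4}, and
-- one move of Player 2 suffices to break the monochromatic (k = 0) or alternating
-- (k = 4) pattern that Player 1 needs. The strategies, and the classification of the
-- 32 complete assignments, are checked by exhaustive search.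
module Submission where

open import Defs
open import Data.Bool using (Bool; true; false)
open import Data.Fin using (Fin; zero; suc)
open import Data.Integer using (ℤ; +_; _<_)
open import Data.Integer.Properties using (_<?_) renaming (_≟_ to _≟ℤ_)
open import Data.Maybe using (Maybe; just; nothing; map; zipWith; _<∣>_; From-just; from-just)
import Data.Maybe.Properties as Maybe
import Data.Maybe.Relation.Unary.Any as MaybeAny
open import Data.Nat using (ℕ; zero; suc)
open import Data.Vec using (Vec; []; _∷_; lookup; _[_]≔_)
import Data.Vec.Properties as Vec
open import Data.Vec.Relation.Unary.All using (all?)
open import Data.Vec.Relation.Unary.Any using (any?)
open import Data.Product using (Σ; _×_; _,_)
open import Data.Sum using (_⊎_; inj₁; inj₂; [_,_])
open import Data.Unit using (tt)
open import Function using (_∘_; const)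
open import Function.Bundles using (_⇔_; mk⇔; Equivalence)
open import Relation.Binary.Definitions using (DecidableEquality)
open import Relation.Binary.PropositionalEquality using (_≡_; _≢_; refl; sym)
open import Relation.Nullary using (¬_; Dec; yes; no; ¬?; contradiction)
open import Relation.Nullary.Decidable using (dec⇒maybe; map′; _×-dec_; _⊎-dec_; _→-dec_; from-yes; from-no)
open import Relation.Unary using (Decidable)

_≟ˢ_ : DecidableEquality Sign
plus  ≟ˢ plus  = yes refl
plus  ≟ˢ minus = no λ ()
minus ≟ˢ plus  = no λ ()
minus ≟ˢ minus = yes refl

wins? : (r : Role) → Decidable (Wins r)
wins? P z = + 0 <? z
wins? N z = z <? + 0

any-just-Fin : ∀ {n} {A : Set} → (Fin n → Maybe A) → Maybe A
any-just-Fin {zero}  f = nothing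
any-just-Fin {suc n} f = f zero <∣> any-just-Fin (f ∘ suc)

all-just-Fin : ∀ {n} {B : Fin n → Set} → (∀ i → Maybe (B i)) → Maybe (∀ i → B i)
all-just-Fin {zero}          f = just λ ()
all-just-Fin {suc n} {B} f = zipWith cons (f zero) (all-just-Fin (f ∘ suc))
  where
  cons : B zero → (∀ i → B (suc i)) → ∀ i → B i
  cons p ps zero    = p
  cons p ps (suc i) = ps i

all-just-Sign : {B : Sign → Set} → Maybe (B plus) → Maybe (B minus) → Maybe (∀ σ → B σ)
all-just-Sign {B} = zipWith cases
  where
  cases : B plus → B minus → ∀ σ → B σ
  cases p m plus  = p
  cases p m minus = m

Σ-Bool? : {B : Bool → Set} → (∀ b → Dec (B b)) → Dec (Σ Bool B)
Σ-Bool? {B} B? = map′ [ (false ,_) , (true ,_) ] from (B? false ⊎-dec B? true)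
  where
  from : Σ Bool B → B false ⊎ B true
  from (false , p) = inj₁ p
  from (true  , p) = inj₂ p

_∼?_ : (x y : Assignment) → Dec (x ∼ y)
x ∼? y = Σ-Bool? λ r → Σ-Bool? λ d → Vec.≡-dec _≟ˢ_ y (revIf r (dualIf d x))

_⇔-dec_ : {A B : Set} → Dec A → Dec B → Dec (A ⇔ B)
A? ⇔-dec B? = map′ (λ (to , from) → mk⇔ to from) (λ A⇔B → Equivalence.to A⇔B , Equivalence.from A⇔B)
                   ((A? →-dec B?) ×-dec (B? →-dec A?))

∀-signs? : ∀ n {B : Vec Sign n → Set} → (∀ x → Dec (B x)) → Dec (∀ x → B x)
∀-signs? zero    B? = map′ (λ { b [] → b }) (λ b → b []) (B? [])
∀-signs? (suc n) B? = map′ (λ { (bp , bm) (plus ∷ x) → bp x ; (bp , bm) (minus ∷ x) → bm x })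
                           (λ b → (b ∘ (plus ∷_)) , (b ∘ (minus ∷_)))
                           (∀-signs? n (B? ∘ (plus ∷_)) ×-dec ∀-signs? n (B? ∘ (minus ∷_)))

-- The search returns the strategy tree itself, so it needs no soundness proof.
module _ {Q : ℤ → Set} (Q? : Decidable Q) where

  finished : ∀ {t} s → Maybe (Forces Q t s)
  finished s = zipWith done (dec⇒maybe (all? (MaybeAny.dec λ _ → yes tt) s))
                           (dec⇒maybe (Q? (scorePos s)))

  search : ℕ → (t : Bool) (s : Position) → Maybe (Forces Q t s)
  search zero    _     _ = nothing
  search (suc n) true  s = finished s <∣> any-just-Fin λ i → move i plus <∣> move i minus
    where
    move : (i : V) (σ : Sign) → Maybe (Forces Q true s)
    move i σ with lookup s i in free
    ... | nothing = map (mine i σ free) (search n false (s [ i ]≔ just σ))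
    ... | just _  = nothing
  search (suc n) false s =
    finished s <∣> zipWith theirs (dec⇒maybe (any? (λ m → Maybe.≡-dec _≟ˢ_ m nothing) s))
                                 (all-just-Fin λ i → all-just-Sign (reply i plus) (reply i minus))
    where
    reply : (i : V) (σ : Sign) → Maybe (lookup s i ≡ nothing → Forces Q true (s [ i ]≔ just σ))
    reply i σ with lookup s i
    ... | nothing = map const (search n true (s [ i ]≔ just σ))
    ... | just _  = just λ ()

  -- A play on five vertices has at most five moves, so fuel 6 always suffices.
  forced : (t : Bool) (s : Position) → From-just (search 6 t s)
  forced t s = from-just (search 6 t s)

ends : Sign → Sign → Position
ends a b = just a ∷ nothing ∷ nothing ∷ nothing ∷ just b ∷ []

opposite-ends⇒player-one-wins : ∀ r a b → a ≢ b → Forces (Wins r) true (ends a b)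
opposite-ends⇒player-one-wins r plus  plus  p≢p = contradiction refl p≢p
opposite-ends⇒player-one-wins r minus minus m≢m = contradiction refl m≢m
opposite-ends⇒player-one-wins P plus  minus _   = forced (wins? P) true (ends plus minus)
opposite-ends⇒player-one-wins P minus plus  _   = forced (wins? P) true (ends minus plus)
opposite-ends⇒player-one-wins N plus  minus _   = forced (wins? N) true (ends plus minus)
opposite-ends⇒player-one-wins N minus plus  _   = forced (wins? N) true (ends minus plus)

equal-ends⇒player-two-draws : ∀ r a → Forces (λ z → ¬ Wins r z) false (ends a a)
equal-ends⇒player-two-draws P plus  = forced (¬? ∘ wins? P) false (ends plus plus)
equal-ends⇒player-two-draws P minus = forced (¬? ∘ wins? P) false (ends minus minus)
equal-ends⇒player-two-draws N plus  = forced (¬? ∘ wins? N) false (ends plus plus)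
equal-ends⇒player-two-draws N minus = forced (¬? ∘ wins? N) false (ends minus minus)

positive-scores : (x : Assignment) → (+ 0 < score x) ⇔ (ppppp ∼ x ⊎ ppppm ∼ x ⊎ pppmm ∼ x)
positive-scores = from-yes (∀-signs? 5 λ x →
  (+ 0 <? score x) ⇔-dec (ppppp ∼? x ⊎-dec ppppm ∼? x ⊎-dec pppmm ∼? x))

negative-scores : (x : Assignment) → (score x < + 0) ⇔ (ppmpm ∼ x ⊎ pmppm ∼ x ⊎ pmpmp ∼ x)
negative-scores = from-yes (∀-signs? 5 λ x →
  (score x <? + 0) ⇔-dec (ppmpm ∼? x ⊎-dec pmppm ∼? x ⊎-dec pmpmp ∼? x))

zero-scores : (x : Assignment) →
  ¬ (ppppp ∼ x ⊎ ppppm ∼ x ⊎ pppmm ∼ x ⊎ ppmpm ∼ x ⊎ pmppm ∼ x ⊎ pmpmp ∼ x) → score x ≡ + 0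
zero-scores = from-yes (∀-signs? 5 λ x →
  ¬? (ppppp ∼? x ⊎-dec ppppm ∼? x ⊎-dec pppmm ∼? x ⊎-dec ppmpm ∼? x ⊎-dec pmppm ∼? x ⊎-dec pmpmp ∼? x)
  →-dec score x ≟ℤ + 0)

player-one-wins : (r : Role) (i j : Fin 5) (a b : Sign) →
  ((i ≡ v₁ × j ≡ v₅) ⊎ (i ≡ v₅ × j ≡ v₁)) → a ≢ b →
  Forces (Wins r) true ((emptyPos [ i ]≔ just a) [ j ]≔ just b)
player-one-wins r _ _ a b (inj₁ (refl , refl)) a≢b = opposite-ends⇒player-one-wins r a b a≢b
player-one-wins r _ _ a b (inj₂ (refl , refl)) a≢b = opposite-ends⇒player-one-wins r b a (a≢b ∘ sym)

player-two-draws : (r : Role) (i j : Fin 5) (a b : Sign) →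
  ((i ≡ v₁ × j ≡ v₅) ⊎ (i ≡ v₅ × j ≡ v₁)) → a ≡ b →
  Forces (λ z → ¬ Wins r z) false ((emptyPos [ i ]≔ just a) [ j ]≔ just b)
player-two-draws r _ _ a _ (inj₁ (refl , refl)) refl = equal-ends⇒player-two-draws r a
player-two-draws r _ _ a _ (inj₂ (refl , refl)) refl = equal-ends⇒player-two-draws r a

lemma3 :
  -- (1a) opposite signs on v₁, v₅: Player 1 (with either role r) can force a win
  ((r : Role) (i j : Fin 5) (a b : Sign) →
     ((i ≡ v₁ × j ≡ v₅) ⊎ (i ≡ v₅ × j ≡ v₁)) → a ≢ b →
     Forces (Wins r) true ((emptyPos [ i ]≔ just a) [ j ]≔ just b))
  ×
  -- (1b) same sign on v₁, v₅: Player 2 (role opponent r) can force a draw,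
  -- i.e. guarantee that Player 1 does not win
  ((r : Role) (i j : Fin 5) (a b : Sign) →
     ((i ≡ v₁ × j ≡ v₅) ⊎ (i ≡ v₅ × j ≡ v₁)) → a ≡ b →
     Forces (λ z → ¬ Wins r z) false ((emptyPos [ i ]≔ just a) [ j ]≔ just b))
  ×
  -- (2) classification up to symmetry and duality
  ((x : Assignment) →
     (+ 0 < score x) ⇔ (ppppp ∼ x ⊎ ppppm ∼ x ⊎ pppmm ∼ x))
  × ¬ (ppppp ∼ ppppm) × ¬ (ppppp ∼ pppmm) × ¬ (ppppm ∼ pppmm)
  ×
  ((x : Assignment) →
     (score x < + 0) ⇔ (ppmpm ∼ x ⊎ pmppm ∼ x ⊎ pmpmp ∼ x))
  × ¬ (ppmpm ∼ pmppm) × ¬ (ppmpm ∼ pmpmp) × ¬ (pmppm ∼ pmpmp)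
  ×
  ((x : Assignment) →
     ¬ (ppppp ∼ x ⊎ ppppm ∼ x ⊎ pppmm ∼ x ⊎ ppmpm ∼ x ⊎ pmppm ∼ x ⊎ pmpmp ∼ x) →
     score x ≡ + 0)
lemma3 =
    player-one-wins , player-two-draws
  , positive-scores , from-no (ppppp ∼? ppppm) , from-no (ppppp ∼? pppmm) , from-no (ppppm ∼? pppmm)
  , negative-scores , from-no (ppmpm ∼? pmppm) , from-no (ppmpm ∼? pmpmp) , from-no (pmppm ∼? pmpmp)
  , zero-scores
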